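{- Let $\Gamma$ be a strongly regular graph with parameters $(v,k,\lambda,\mu)$, let $d$ be a non-negative integer, and suppose $\Delta$ is a $d$-regular induced subgraph of $\Gamma$ of order $y>0$. Then $$\mathrm{Rab}_{\leq}(\Gamma,d)\leq y\leq \mathrm{Rab}_{\geq}(\Gamma,d).$$
   Context: A graph is strongly regular with parameters $(v,k,\lambda,\mu)$ if it has $v$ vertices, is $k$-regular, is neither complete nor edgeless, every two adjacent vertices have exactly $\lambda$ common neighbours, and every two distinct non-adjacent vertices have exactly $\mu$ common neighbours. The regular adjacency polynomial of $\Gamma$ is $$R_\Gamma(x,y,d)=x(x+1)(v-y)-2xyk+(2x+\lambda-\mu+1)yd+y(y-1)\mu-yd^2.$$ For a non-negative integer $d$ let $S_d=\{y\in\{d+1,\dots,v\}: R_\Gamma(x,y,d)\ge 0 \text{ for all integers } x\}$. Define $\mathrm{Rab}_{\geq}(\Gamma,d)=\max S_d$ if $S_d\neq\emptyset$ and $0$ otherwise, and $\mathrm{Rab}_{\leq}(\Gamma,d)=\min S_d$ if $S_d\ne\emptyset$ and $v+1$ otherwise. -}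

module Defs where

open import Data.Nat using (ℕ; _≤_; _<_)
open import Data.Integer as ℤ using (ℤ; +_)
open import Data.Bool using (Bool; true; false; _∧_)
open import Data.Fin using (Fin)
open import Data.Fin.Subset using (Subset; _∈_; ∣_∣)
open import Data.List using (List; length; filterᵇ)
open import Data.Product using (Σ; _×_; ∃; ∃-syntax)
open import Data.Sum using (_⊎_)
open import Relation.Binary.PropositionalEquality using (_≡_; _≢_)
open import Relation.Nullary using (¬_)
open import Data.List using (allFin)

record Graph (n : ℕ) : Set where
  field
    adj   : Fin n → Fin n → Bool
    sym   : ∀ i j → adj i j ≡ adj j i
    irrefl : ∀ i → adj i i ≡ false
open Graph public

countᵇ : ∀ {n} → (Fin n → Bool) → ℕ
countᵇ {n} p = length (filterᵇ p (allFin n))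

degree : ∀ {n} → Graph n → Fin n → ℕ
degree G i = countᵇ (λ w → adj G i w)

commonNbrs : ∀ {n} → Graph n → Fin n → Fin n → ℕ
commonNbrs G i j = countᵇ (λ w → adj G i w ∧ adj G j w)

record IsSRG {v : ℕ} (G : Graph v) (k lam mu : ℕ) : Set where
  field
    regular      : ∀ i → degree G i ≡ k
    notEdgeless  : ∃[ i ] ∃[ j ] adj G i j ≡ true
    notComplete  : ∃[ i ] ∃[ j ] (i ≢ j × adj G i j ≡ false)
    adjCommon    : ∀ i j → adj G i j ≡ true → commonNbrs G i j ≡ lam
    nonadjCommon : ∀ i j → i ≢ j → adj G i j ≡ false → commonNbrs G i j ≡ mu

R : (v k lam mu : ℕ) → ℤ → ℤ → ℤ → ℤ
R v k lam mu x y d =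
  x ℤ.* (x ℤ.+ + 1) ℤ.* (+ v ℤ.- y)
  ℤ.- + 2 ℤ.* x ℤ.* y ℤ.* + k
  ℤ.+ (+ 2 ℤ.* x ℤ.+ + lam ℤ.- + mu ℤ.+ + 1) ℤ.* y ℤ.* d
  ℤ.+ y ℤ.* (y ℤ.- + 1) ℤ.* + mu
  ℤ.- y ℤ.* d ℤ.* d

InS : (v k lam mu d : ℕ) → ℕ → Set
InS v k lam mu d y =
  Data.Nat._<_ d y × y ≤ v × (∀ (x : ℤ) → + 0 ℤ.≤ R v k lam mu x (+ y) (+ d))

IsRabGe : (v k lam mu d : ℕ) → ℕ → Set
IsRabGe v k lam mu d r =
  (InS v k lam mu d r × (∀ y → InS v k lam mu d y → y ≤ r))
  ⊎ ((∀ y → ¬ InS v k lam mu d y) × r ≡ 0)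

IsRabLe : (v k lam mu d : ℕ) → ℕ → Set
IsRabLe v k lam mu d r =
  (InS v k lam mu d r × (∀ y → InS v k lam mu d y → r ≤ y))
  ⊎ ((∀ y → ¬ InS v k lam mu d y) × r ≡ Data.Nat.suc v)

IsRegularInducedSubgraph : ∀ {v} → Graph v → Subset v → ℕ → ℕ → Set
IsRegularInducedSubgraph {v} G S d y =
  ∣ S ∣ ≡ y × (∀ i → i ∈ S → countᵇ (λ w → adj G i w ∧ Data.Vec.lookup S w) ≡ d)
  where import Data.Vec

module Submission where

-- For a vertex w outside Δ let N w be its number of neighbours in Δ. For every integer x,
-- (N w - x)(N w - x - 1) ≥ 0, and the sum of these over the vertices outside Δ is exactly
-- R(x, y, d): double counting gives Σ N = k y and Σ N² = y (μ y + k - μ + (λ - μ) d), while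
-- N = d on Δ. Together with d < y (a vertex of Δ and its d neighbours lie in Δ) this puts y
-- in S_d, so y lies between the minimum and the maximum of S_d.

import Algebra.Properties.Semiring.Sum
open import Data.Bool using (Bool; true; false; _∧_; if_then_else_)
open import Data.Empty using (⊥-elim)
open import Data.Fin using (Fin; zero; suc)
open import Data.Fin.Properties using (_≟_)
open import Data.Fin.Subset using (Subset; _∈_; ∣_∣; Nonempty)
open import Data.Fin.Subset.Properties using (∣p∣≤n; ∣⊥∣≡0; nonempty?; Empty-unique)
open import Data.Integer as ℤ using (ℤ; +_; -[1+_]; _+_; _*_; _-_; -_; +≤+)
import Data.Integer.Properties as ℤ
open import Data.Integer.Tactic.RingSolver using (solve-∀)
open import Data.List using (length; filterᵇ; tabulate)
open import Data.Nat as ℕ using (ℕ; zero; suc; _≤_; _<_; z≤n)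
import Data.Nat.Properties as ℕ
open import Data.Product using (_×_; _,_)
open import Data.Sum using (inj₁; inj₂)
open import Data.Vec using ([]; _∷_; lookup)
open import Data.Vec.Properties using (lookup⇒[]=; []=⇒lookup)
open import Function using (_∘_; id)
open import Relation.Binary.PropositionalEquality
open import Relation.Nullary using (does; yes; no; contradiction)

open import Defs renaming (sym to adj-sym)

open Algebra.Properties.Semiring.Sum ℤ.+-*-semiring
  using (sum; sum-syntax; sum-cong-≗; sum-replicate-zero; ∑-comm; ∑-distrib-+;
         *-distribˡ-sum; *-distribʳ-sum)

𝟙 : Bool → ℤ
𝟙 b = if b then + 1 else + 0

𝟙-∧ : ∀ b c → 𝟙 (b ∧ c) ≡ 𝟙 b * 𝟙 c
𝟙-∧ true  c = sym (ℤ.*-identityˡ (𝟙 c))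
𝟙-∧ false c = refl

𝟙-idem : ∀ b → 𝟙 b * 𝟙 b ≡ 𝟙 b
𝟙-idem true  = refl
𝟙-idem false = refl

δ : ∀ {n} → Fin n → Fin n → ℤ
δ a b = 𝟙 (does (a ≟ b))

∑-ones : ∀ n → ∑[ i < n ] (+ 1) ≡ + n
∑-ones zero    = refl
∑-ones (suc n) = cong (_+_ (+ 1)) (∑-ones n)

∑-*ˡ : ∀ {n} c (f : Fin n → ℤ) → ∑[ i < n ] (c * f i) ≡ c * sum f
∑-*ˡ c f = sym (*-distribˡ-sum c f)

∑-*ʳ : ∀ {n} c (f : Fin n → ℤ) → ∑[ i < n ] (f i * c) ≡ sum f * c
∑-*ʳ c f = sym (*-distribʳ-sum c f)

∑-distrib-- : ∀ {n} (f g : Fin n → ℤ) → ∑[ i < n ] (f i - g i) ≡ sum f - sum g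
∑-distrib-- {zero}  f g = refl
∑-distrib-- {suc n} f g =
  trans (cong (_+_ (f zero - g zero)) (∑-distrib-- (f ∘ suc) (g ∘ suc)))
        (interchange (f zero) (g zero) (sum (f ∘ suc)) (sum (g ∘ suc)))
  where
  interchange : ∀ a b c d → (a - b) + (c - d) ≡ (a + c) - (b + d)
  interchange = solve-∀

∑-linear₃ : ∀ {n} a b c (f g h : Fin n → ℤ) →
  ∑[ i < n ] (a * f i + b * g i + c * h i) ≡ a * sum f + b * sum g + c * sum h
∑-linear₃ {n} a b c f g h = begin
  ∑[ i < n ] (a * f i + b * g i + c * h i)
    ≡⟨ ∑-distrib-+ (λ i → a * f i + b * g i) (λ i → c * h i) ⟩
  ∑[ i < n ] (a * f i + b * g i) + ∑[ i < n ] (c * h i)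
    ≡⟨ cong₂ _+_ (∑-distrib-+ (λ i → a * f i) (λ i → b * g i)) (∑-*ˡ c h) ⟩
  ∑[ i < n ] (a * f i) + ∑[ i < n ] (b * g i) + c * sum h
    ≡⟨ cong (λ t → t + c * sum h) (cong₂ _+_ (∑-*ˡ a f) (∑-*ˡ b g)) ⟩
  a * sum f + b * sum g + c * sum h ∎
  where open ≡-Reasoning

∑-*-∑ : ∀ {m n} (f : Fin m → ℤ) (g : Fin n → ℤ) →
  sum f * sum g ≡ ∑[ i < m ] ∑[ j < n ] (f i * g j)
∑-*-∑ f g = trans (sym (∑-*ʳ (sum g) f)) (sum-cong-≗ λ i → sym (∑-*ˡ (f i) g))

∑-δ : ∀ {n} a (f : Fin n → ℤ) → ∑[ b < n ] (δ a b * f b) ≡ f a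
∑-δ {suc n} zero f =
  trans (cong₂ _+_ (ℤ.*-identityˡ (f zero)) (sum-replicate-zero n)) (ℤ.+-identityʳ (f zero))
∑-δ {suc n} (suc a) f = trans (ℤ.+-identityˡ _) (∑-δ a (f ∘ suc))

∑-mono-≤ : ∀ {n} {f g : Fin n → ℤ} → (∀ i → f i ℤ.≤ g i) → sum f ℤ.≤ sum g
∑-mono-≤ {zero}  f≤g = ℤ.≤-refl
∑-mono-≤ {suc n} f≤g = ℤ.+-mono-≤ (f≤g zero) (∑-mono-≤ (f≤g ∘ suc))

∑-nonneg : ∀ {n} {f : Fin n → ℤ} → (∀ i → + 0 ℤ.≤ f i) → + 0 ℤ.≤ sum f
∑-nonneg {n} {f} 0≤f = subst (ℤ._≤ sum f) (sum-replicate-zero n) (∑-mono-≤ 0≤f)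

count-∑ : ∀ {n} (p : Fin n → Bool) → + countᵇ p ≡ ∑[ i < n ] 𝟙 (p i)
count-∑ p = filter-tabulate-∑ p id
  where
  filter-tabulate-∑ : ∀ {m n} (p : Fin m → Bool) (g : Fin n → Fin m) →
    + length (filterᵇ p (tabulate g)) ≡ ∑[ i < n ] 𝟙 (p (g i))
  filter-tabulate-∑ {n = zero}  p g = refl
  filter-tabulate-∑ {n = suc n} p g with p (g zero)
  ... | true  = cong (_+_ (+ 1)) (filter-tabulate-∑ p (g ∘ suc))
  ... | false = trans (filter-tabulate-∑ p (g ∘ suc)) (sym (ℤ.+-identityˡ _))

∣∣-∑ : ∀ {n} (S : Subset n) → + ∣ S ∣ ≡ ∑[ i < n ] 𝟙 (lookup S i)
∣∣-∑ []          = refl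
∣∣-∑ (true  ∷ S) = cong (_+_ (+ 1)) (∣∣-∑ S)
∣∣-∑ (false ∷ S) = trans (∣∣-∑ S) (sym (ℤ.+-identityˡ _))

consecutive-product-nonneg : ∀ m → + 0 ℤ.≤ m * (m - + 1)
consecutive-product-nonneg (+ zero)  = +≤+ z≤n
consecutive-product-nonneg (+ suc n) = subst (+ 0 ℤ.≤_) (sym (ℤ.+◃n≡+n _)) (+≤+ z≤n)
consecutive-product-nonneg -[1+ n ]  = +≤+ z≤n

𝟙-complement-*-nonneg : ∀ b {m} → + 0 ℤ.≤ m → + 0 ℤ.≤ (+ 1 - 𝟙 b) * m
𝟙-complement-*-nonneg true  _   = +≤+ z≤n
𝟙-complement-*-nonneg false {m} 0≤m = subst (+ 0 ℤ.≤_) (sym (ℤ.*-identityˡ m)) 0≤m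

≤1⇒*𝟙≤𝟙 : ∀ {m} b → m ℤ.≤ + 1 → m * 𝟙 b ℤ.≤ 𝟙 b
≤1⇒*𝟙≤𝟙 {m} true  m≤1 = subst (ℤ._≤ + 1) (sym (ℤ.*-identityʳ m)) m≤1
≤1⇒*𝟙≤𝟙 {m} false _   = ℤ.≤-reflexive (ℤ.*-zeroʳ m)

∑-outside-consecutive-nonneg : ∀ {n} (b : Fin n → Bool) (N : Fin n → ℤ) x →
  + 0 ℤ.≤ ∑[ w < n ] ((+ 1 - 𝟙 (b w)) * ((N w - x) * (N w - x - + 1)))
∑-outside-consecutive-nonneg b N x =
  ∑-nonneg λ w → 𝟙-complement-*-nonneg (b w) (consecutive-product-nonneg (N w - x))

∑-outside-consecutive : ∀ {n} (s N : Fin n → ℤ) x →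
  ∑[ w < n ] ((+ 1 - s w) * ((N w - x) * (N w - x - + 1)))
  ≡ (∑[ w < n ] (N w * N w) - ∑[ w < n ] (s w * (N w * N w)))
    - (+ 2 * x + + 1) * (sum N - ∑[ w < n ] (s w * N w))
    + x * (x + + 1) * (+ n - sum s)
∑-outside-consecutive {n} s N x = begin
  ∑[ w < n ] ((+ 1 - s w) * ((N w - x) * (N w - x - + 1)))
    ≡⟨ sum-cong-≗ (λ w → expand (s w) (N w) x) ⟩
  ∑[ w < n ] (+ 1 * (N² w - sN² w) + c * (N w - sN w) + x * (x + + 1) * (+ 1 - s w))
    ≡⟨ ∑-linear₃ (+ 1) c (x * (x + + 1)) (λ w → N² w - sN² w) (λ w → N w - sN w) (λ w → + 1 - s w) ⟩
  + 1 * ∑[ w < n ] (N² w - sN² w) + c * ∑[ w < n ] (N w - sN w) + x * (x + + 1) * ∑[ w < n ] (+ 1 - s w)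
    ≡⟨ cong₂ _+_ (cong₂ _+_ (trans (ℤ.*-identityˡ _) (∑-distrib-- N² sN²))
                            (cong (c *_) (∑-distrib-- N sN)))
                 (cong (x * (x + + 1) *_) (trans (∑-distrib-- (λ _ → + 1) s) (cong (_- sum s) (∑-ones n)))) ⟩
  (sum N² - sum sN²) + c * (sum N - sum sN) + x * (x + + 1) * (+ n - sum s)
    ≡⟨ cong (λ t → (sum N² - sum sN²) + t + x * (x + + 1) * (+ n - sum s))
            (sym (ℤ.neg-distribˡ-* (+ 2 * x + + 1) (sum N - sum sN))) ⟩
  (sum N² - sum sN²) - (+ 2 * x + + 1) * (sum N - sum sN) + x * (x + + 1) * (+ n - sum s) ∎
  where
  open ≡-Reasoning
  N² sN sN² : Fin n → ℤ
  N² w = N w * N w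
  sN w = s w * N w
  sN² w = s w * (N w * N w)
  c : ℤ
  c = - (+ 2 * x + + 1)
  expand : ∀ t m x → (+ 1 - t) * ((m - x) * (m - x - + 1))
           ≡ + 1 * (m * m - t * (m * m)) + - (+ 2 * x + + 1) * (m - t * m) + x * (x + + 1) * (+ 1 - t)
  expand = solve-∀

adjacency : ∀ {n} → Graph n → Fin n → Fin n → ℤ
adjacency G a b = 𝟙 (adj G a b)

degree-∑ : ∀ {n} (G : Graph n) a → + degree G a ≡ sum (adjacency G a)
degree-∑ G a = count-∑ (adj G a)

commonNbrs-∑ : ∀ {n} (G : Graph n) a b →
  + commonNbrs G a b ≡ ∑[ w < n ] (adjacency G a w * adjacency G b w)
commonNbrs-∑ G a b = trans (count-∑ (λ w → adj G a w ∧ adj G b w)) (sum-cong-≗ λ w → 𝟙-∧ (adj G a w) (adj G b w))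

commonNbrs-self : ∀ {n} (G : Graph n) a → + commonNbrs G a a ≡ + degree G a
commonNbrs-self G a =
  trans (commonNbrs-∑ G a a) (trans (sum-cong-≗ λ w → 𝟙-idem (adj G a w)) (sym (degree-∑ G a)))

δ+adjacency≤1 : ∀ {n} (G : Graph n) a b → δ a b + adjacency G a b ℤ.≤ + 1
δ+adjacency≤1 G a b with a ≟ b
... | yes refl rewrite irrefl G a = ℤ.≤-refl
... | no _ with adj G a b
...   | true  = ℤ.≤-refl
...   | false = +≤+ z≤n

module StronglyRegular {v k lam mu} {G : Graph v} (srg : IsSRG G k lam mu) where
  open IsSRG srg

  commonNbrs-srg : ∀ a b →
    + commonNbrs G a b ≡ + mu + δ a b * (+ k - + mu) + adjacency G a b * (+ lam - + mu)
  commonNbrs-srg a b with a ≟ b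
  ... | yes refl rewrite irrefl G a =
    trans (commonNbrs-self G a) (trans (cong +_ (regular a)) (diagonal (+ k) (+ mu) (+ lam - + mu)))
    where
    diagonal : ∀ k mu c → k ≡ mu + + 1 * (k - mu) + + 0 * c
    diagonal = solve-∀
  ... | no a≢b with adj G a b in a~b
  ...   | true  = trans (cong +_ (adjCommon a b a~b)) (adjacent (+ lam) (+ mu) (+ k - + mu))
    where
    adjacent : ∀ lam mu c → lam ≡ mu + + 0 * c + + 1 * (lam - mu)
    adjacent = solve-∀
  ...   | false = trans (cong +_ (nonadjCommon a b a≢b a~b)) (nonadjacent (+ mu) (+ k - + mu) (+ lam - + mu))
    where
    nonadjacent : ∀ mu c c′ → mu ≡ mu + + 0 * c + + 0 * c′
    nonadjacent = solve-∀

module InducedSubgraph {v} (G : Graph v) (S : Subset v) where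

  s : Fin v → ℤ
  s w = 𝟙 (lookup S w)

  N : Fin v → ℤ
  N w = ∑[ a < v ] (adjacency G w a * s a)

  N-count : ∀ w → N w ≡ + countᵇ (λ a → adj G w a ∧ lookup S a)
  N-count w = sym (trans (count-∑ (λ a → adj G w a ∧ lookup S a))
                         (sum-cong-≗ λ a → 𝟙-∧ (adj G w a) (lookup S a)))

  ∑-N : sum N ≡ ∑[ a < v ] (+ degree G a * s a)
  ∑-N = begin
    ∑[ w < v ] ∑[ a < v ] (adjacency G w a * s a)
      ≡⟨ ∑-comm (λ w a → adjacency G w a * s a) ⟩
    ∑[ a < v ] ∑[ w < v ] (adjacency G w a * s a)
      ≡⟨ sum-cong-≗ (λ a → ∑-*ʳ (s a) (λ w → adjacency G w a)) ⟩
    ∑[ a < v ] (∑[ w < v ] adjacency G w a * s a)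
      ≡⟨ sum-cong-≗ (λ a → cong (_* s a) (trans (sum-cong-≗ λ w → cong 𝟙 (adj-sym G w a))
                                                  (sym (degree-∑ G a)))) ⟩
    ∑[ a < v ] (+ degree G a * s a) ∎
    where open ≡-Reasoning

  ∑-N² : ∑[ w < v ] (N w * N w) ≡ ∑[ a < v ] ∑[ b < v ] (s a * s b * + commonNbrs G a b)
  ∑-N² = begin
    ∑[ w < v ] (N w * N w)
      ≡⟨ sum-cong-≗ (λ w → ∑-*-∑ (λ a → adjacency G w a * s a) (λ b → adjacency G w b * s b)) ⟩
    ∑[ w < v ] ∑[ a < v ] ∑[ b < v ] term w a b
      ≡⟨ ∑-comm (λ w a → ∑[ b < v ] term w a b) ⟩
    ∑[ a < v ] ∑[ w < v ] ∑[ b < v ] term w a b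
      ≡⟨ sum-cong-≗ (λ a → ∑-comm (λ w b → term w a b)) ⟩
    ∑[ a < v ] ∑[ b < v ] ∑[ w < v ] term w a b
      ≡⟨ sum-cong-≗ (λ a → sum-cong-≗ λ b → common-factor a b) ⟩
    ∑[ a < v ] ∑[ b < v ] (s a * s b * + commonNbrs G a b) ∎
    where
    open ≡-Reasoning
    term : Fin v → Fin v → Fin v → ℤ
    term w a b = (adjacency G w a * s a) * (adjacency G w b * s b)
    regroup : ∀ p q x y → (p * x) * (q * y) ≡ x * y * (p * q)
    regroup = solve-∀
    common-factor : ∀ a b → ∑[ w < v ] term w a b ≡ s a * s b * + commonNbrs G a b
    common-factor a b = begin
      ∑[ w < v ] term w a b
        ≡⟨ sum-cong-≗ (λ w → trans (regroup (adjacency G w a) (adjacency G w b) (s a) (s b))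
                                   (cong₂ (λ p q → s a * s b * (p * q)) (cong 𝟙 (adj-sym G w a)) (cong 𝟙 (adj-sym G w b)))) ⟩
      ∑[ w < v ] (s a * s b * (adjacency G a w * adjacency G b w))
        ≡⟨ ∑-*ˡ (s a * s b) (λ w → adjacency G a w * adjacency G b w) ⟩
      s a * s b * ∑[ w < v ] (adjacency G a w * adjacency G b w)
        ≡⟨ cong (s a * s b *_) (sym (commonNbrs-∑ G a b)) ⟩
      s a * s b * + commonNbrs G a b ∎

  module Regular {d} (regular-in-S : ∀ i → i ∈ S → countᵇ (λ w → adj G i w ∧ lookup S w) ≡ d) where

    s*N≡s*d : ∀ w → s w * N w ≡ s w * + d
    s*N≡s*d w with lookup S w in w∈S
    ... | true  = cong (_*_ (+ 1)) (trans (N-count w) (cong +_ (regular-in-S w (lookup⇒[]= w S w∈S))))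
    ... | false = refl

    ∑-s*N : ∑[ w < v ] (s w * N w) ≡ sum s * + d
    ∑-s*N = trans (sum-cong-≗ s*N≡s*d) (∑-*ʳ (+ d) s)

    ∑-s*N² : ∑[ w < v ] (s w * (N w * N w)) ≡ sum s * (+ d * + d)
    ∑-s*N² = trans (sum-cong-≗ λ w → square (s w) (N w) (+ d) (s*N≡s*d w)) (∑-*ʳ (+ d * + d) s)
      where
      square : ∀ t m d → t * m ≡ t * d → t * (m * m) ≡ t * (d * d)
      square t m d tm≡td = begin
        t * (m * m) ≡⟨ sym (ℤ.*-assoc t m m) ⟩
        t * m * m   ≡⟨ cong (_* m) tm≡td ⟩
        t * d * m   ≡⟨ swap t d m ⟩
        t * m * d   ≡⟨ cong (_* d) tm≡td ⟩
        t * d * d   ≡⟨ ℤ.*-assoc t d d ⟩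
        t * (d * d) ∎
        where
        open ≡-Reasoning
        swap : ∀ t d m → t * d * m ≡ t * m * d
        swap = solve-∀

    degree<order : ∀ {i} → i ∈ S → + suc d ℤ.≤ sum s
    degree<order {i} i∈S = subst (ℤ._≤ sum s) self-and-neighbours
      (∑-mono-≤ λ w → ≤1⇒*𝟙≤𝟙 (lookup S w) (δ+adjacency≤1 G i w))
      where
      self-and-neighbours : ∑[ w < v ] ((δ i w + adjacency G i w) * s w) ≡ + 1 + + d
      self-and-neighbours = begin
        ∑[ w < v ] ((δ i w + adjacency G i w) * s w)
          ≡⟨ sum-cong-≗ (λ w → ℤ.*-distribʳ-+ (s w) (δ i w) (adjacency G i w)) ⟩
        ∑[ w < v ] (δ i w * s w + adjacency G i w * s w)
          ≡⟨ ∑-distrib-+ (λ w → δ i w * s w) (λ w → adjacency G i w * s w) ⟩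
        ∑[ w < v ] (δ i w * s w) + N i
          ≡⟨ cong₂ _+_ (∑-δ i s) (trans (N-count i) (cong +_ (regular-in-S i i∈S))) ⟩
        s i + + d
          ≡⟨ cong (λ t → 𝟙 t + + d) ([]=⇒lookup i∈S) ⟩
        + 1 + + d ∎
        where open ≡-Reasoning

    module _ {k lam mu} (srg : IsSRG G k lam mu) where
      open IsSRG srg using (regular)
      open StronglyRegular srg using (commonNbrs-srg)

      ∑-N-srg : sum N ≡ + k * sum s
      ∑-N-srg = trans ∑-N (trans (sum-cong-≗ λ a → cong (λ t → + t * s a) (regular a)) (∑-*ˡ (+ k) s))

      ∑-N²-srg : ∑[ w < v ] (N w * N w)
                 ≡ + mu * (sum s * sum s) + (+ k - + mu) * sum s + (+ lam - + mu) * (sum s * + d)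
      ∑-N²-srg = begin
        ∑[ w < v ] (N w * N w)
          ≡⟨ ∑-N² ⟩
        ∑[ a < v ] ∑[ b < v ] (s a * s b * + commonNbrs G a b)
          ≡⟨ sum-cong-≗ row ⟩
        ∑[ a < v ] (+ mu * (s a * sum s) + (+ k - + mu) * (s a * s a) + (+ lam - + mu) * (s a * N a))
          ≡⟨ ∑-linear₃ (+ mu) (+ k - + mu) (+ lam - + mu) (λ a → s a * sum s) (λ a → s a * s a) (λ a → s a * N a) ⟩
        + mu * ∑[ a < v ] (s a * sum s) + (+ k - + mu) * ∑[ a < v ] (s a * s a) + (+ lam - + mu) * ∑[ a < v ] (s a * N a)
          ≡⟨ cong₂ _+_ (cong₂ _+_ (cong (+ mu *_) (∑-*ʳ (sum s) s))
                                  (cong ((+ k - + mu) *_) (sum-cong-≗ λ a → 𝟙-idem (lookup S a))))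
                       (cong ((+ lam - + mu) *_) ∑-s*N) ⟩
        + mu * (sum s * sum s) + (+ k - + mu) * sum s + (+ lam - + mu) * (sum s * + d) ∎
        where
        open ≡-Reasoning
        distribute : ∀ x y mu e c α c′ → x * y * (mu + e * c + α * c′)
                     ≡ mu * (x * y) + c * (x * (e * y)) + c′ * (x * (α * y))
        distribute = solve-∀
        row : ∀ a → ∑[ b < v ] (s a * s b * + commonNbrs G a b)
                    ≡ + mu * (s a * sum s) + (+ k - + mu) * (s a * s a) + (+ lam - + mu) * (s a * N a)
        row a = begin
          ∑[ b < v ] (s a * s b * + commonNbrs G a b)
            ≡⟨ sum-cong-≗ (λ b → trans (cong (s a * s b *_) (commonNbrs-srg a b))
                 (distribute (s a) (s b) (+ mu) (δ a b) (+ k - + mu) (adjacency G a b) (+ lam - + mu))) ⟩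
          ∑[ b < v ] (+ mu * (s a * s b) + (+ k - + mu) * (s a * (δ a b * s b))
                      + (+ lam - + mu) * (s a * (adjacency G a b * s b)))
            ≡⟨ ∑-linear₃ (+ mu) (+ k - + mu) (+ lam - + mu) (λ b → s a * s b)
                 (λ b → s a * (δ a b * s b)) (λ b → s a * (adjacency G a b * s b)) ⟩
          + mu * ∑[ b < v ] (s a * s b) + (+ k - + mu) * ∑[ b < v ] (s a * (δ a b * s b))
            + (+ lam - + mu) * ∑[ b < v ] (s a * (adjacency G a b * s b))
            ≡⟨ cong₂ _+_ (cong₂ _+_ (cong (+ mu *_) (∑-*ˡ (s a) s))
                                    (cong ((+ k - + mu) *_) (trans (∑-*ˡ (s a) (λ b → δ a b * s b)) (cong (s a *_) (∑-δ a s)))))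
                         (cong ((+ lam - + mu) *_) (∑-*ˡ (s a) (λ b → adjacency G a b * s b))) ⟩
          + mu * (s a * sum s) + (+ k - + mu) * (s a * s a) + (+ lam - + mu) * (s a * N a) ∎

R-from-moments : ∀ v k lam mu x y d →
  R v k lam mu x y d
  ≡ ((+ mu * (y * y) + (+ k - + mu) * y + (+ lam - + mu) * (y * d)) - y * (d * d))
    - (+ 2 * x + + 1) * (+ k * y - y * d) + x * (x + + 1) * (+ v - y)
R-from-moments v k lam mu = identity (+ v) (+ k) (+ lam) (+ mu)
  where
  identity : ∀ v k lam mu x y d →
    x * (x + + 1) * (v - y) - + 2 * x * y * k + (+ 2 * x + lam - mu + + 1) * y * d
      + y * (y - + 1) * mu - y * d * d
    ≡ ((mu * (y * y) + (k - mu) * y + (lam - mu) * (y * d)) - y * (d * d))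
      - (+ 2 * x + + 1) * (k * y - y * d) + x * (x + + 1) * (v - y)
  identity = solve-∀

nonempty-of-positive-size : ∀ {n} (S : Subset n) → 0 < ∣ S ∣ → Nonempty S
nonempty-of-positive-size {n} S 0<∣S∣ with nonempty? S
... | yes S≢∅ = S≢∅
... | no  S≡∅ = contradiction (trans (cong ∣_∣ (Empty-unique S≡∅)) (∣⊥∣≡0 n)) (ℕ.>⇒≢ 0<∣S∣)

regular-induced-order-∈S : ∀ {v k lam mu} {G : Graph v} → IsSRG G k lam mu →
  ∀ {d y S} → IsRegularInducedSubgraph G S d y → 0 < y → InS v k lam mu d y
regular-induced-order-∈S {v} {k} {lam} {mu} {G} srg {d} {y} {S} (∣S∣≡y , regular-in-S) 0<y =
  d<y , subst (_≤ v) ∣S∣≡y (∣p∣≤n S) , R≥0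
  where
  open InducedSubgraph G S
  open Regular regular-in-S

  order : sum s ≡ + y
  order = trans (sym (∣∣-∑ S)) (cong +_ ∣S∣≡y)

  d<y : d < y
  d<y with nonempty-of-positive-size S (subst (0 <_) (sym ∣S∣≡y) 0<y)
  ... | i , i∈S = ℤ.drop‿+≤+ (subst (+ suc d ℤ.≤_) order (degree<order i∈S))

  R≥0 : ∀ x → + 0 ℤ.≤ R v k lam mu x (+ y) (+ d)
  R≥0 x = subst (λ t → + 0 ℤ.≤ R v k lam mu x t (+ d)) order
    (subst (+ 0 ℤ.≤_) outside-sum≡R (∑-outside-consecutive-nonneg (lookup S) N x))
    where
    outside-sum≡R : ∑[ w < v ] ((+ 1 - s w) * ((N w - x) * (N w - x - + 1))) ≡ R v k lam mu x (sum s) (+ d)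
    outside-sum≡R = begin
      ∑[ w < v ] ((+ 1 - s w) * ((N w - x) * (N w - x - + 1)))
        ≡⟨ ∑-outside-consecutive s N x ⟩
      (∑[ w < v ] (N w * N w) - ∑[ w < v ] (s w * (N w * N w)))
        - (+ 2 * x + + 1) * (sum N - ∑[ w < v ] (s w * N w)) + x * (x + + 1) * (+ v - sum s)
        ≡⟨ cong₂ (λ p q → p - (+ 2 * x + + 1) * q + x * (x + + 1) * (+ v - sum s))
                 (cong₂ _-_ (∑-N²-srg srg) ∑-s*N²) (cong₂ _-_ (∑-N-srg srg) ∑-s*N) ⟩
      ((+ mu * (sum s * sum s) + (+ k - + mu) * sum s + (+ lam - + mu) * (sum s * + d)) - sum s * (+ d * + d))
        - (+ 2 * x + + 1) * (+ k * sum s - sum s * + d) + x * (x + + 1) * (+ v - sum s)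
        ≡⟨ sym (R-from-moments v k lam mu x (sum s) (+ d)) ⟩
      R v k lam mu x (sum s) (+ d) ∎
      where open ≡-Reasoning

IsRabLe⇒≤ : ∀ {v k lam mu d r y} → IsRabLe v k lam mu d r → InS v k lam mu d y → r ≤ y
IsRabLe⇒≤ (inj₁ (_ , minimal)) y∈S = minimal _ y∈S
IsRabLe⇒≤ (inj₂ (S≡∅ , _))     y∈S = ⊥-elim (S≡∅ _ y∈S)

IsRabGe⇒≥ : ∀ {v k lam mu d r y} → IsRabGe v k lam mu d r → InS v k lam mu d y → y ≤ r
IsRabGe⇒≥ (inj₁ (_ , maximal)) y∈S = maximal _ y∈S
IsRabGe⇒≥ (inj₂ (S≡∅ , _))     y∈S = ⊥-elim (S≡∅ _ y∈S)

theorem4p2 : ∀ {v k lam mu : ℕ} (G : Graph v) → IsSRG G k lam mu →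
    (d y : ℕ) (S : Subset v) → IsRegularInducedSubgraph G S d y → 0 < y →
    (r₁ r₂ : ℕ) → IsRabLe v k lam mu d r₁ → IsRabGe v k lam mu d r₂ →
    r₁ ≤ y × y ≤ r₂
theorem4p2 G srg d y S Δ 0<y r₁ r₂ r₁≡Rab≤ r₂≡Rab≥ =
  IsRabLe⇒≤ r₁≡Rab≤ y∈S , IsRabGe⇒≥ r₂≡Rab≥ y∈S
  where
  y∈S : InS _ _ _ _ d y
  y∈S = regular-induced-order-∈S srg Δ 0<y
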